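{- Let $u$ be a positive integer. If $u\ge 7.51\cdot10^{358}$, then $W(u)\le u^{1/8}$. If $u\ge 1.39\cdot10^{1424}$, then $W(u)\le u^{1/10}$. If $u\ge 3.31\cdot 10^{2821}$, then $W(u)\le u^{1/11}$.
   Context: $W(u)$ denotes the number of squarefree positive divisors of $u$. -}

module Defs where

open import Data.Nat using (ℕ; suc; _+_; _*_)
open import Data.Nat.Divisibility using (_∣_; _∣?_)
open import Data.List using (List; applyUpTo; filter; length)
open import Data.List.Relation.Unary.All using (All; all?)
open import Data.Product using (_×_)
open import Relation.Nullary using (¬_; Dec; ¬?)
open import Relation.Nullary.Decidable using (_×-dec_)

-- n is squarefree: no square k*k with k ≥ 2 divides n.
-- (For n ≥ 1, k * k ∣ n forces k ≤ n, so checking k ∈ {2, …, n+1} suffices.)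
SquareFree : ℕ → Set
SquareFree n = All (λ k → ¬ (k * k ∣ n)) (applyUpTo (2 +_) n)

squareFree? : (n : ℕ) → Dec (SquareFree n)
squareFree? n = all? (λ k → ¬? (k * k ∣? n)) (applyUpTo (2 +_) n)

range1 : ℕ → List ℕ
range1 u = applyUpTo suc u

W : ℕ → ℕ
W u = length (filter (λ d → (d ∣? u) ×-dec squareFree? d) (range1 u))

{-# OPTIONS --safe #-}
-- Peeling off the least prime factor p of u = p * m gives W u ≤ W m when p ∣ m and
-- W u ≤ 2 * W m otherwise, so by induction W u ≤ 2 ^ k and u ≥ p₁ p₂ ⋯ p_k (the first k
-- primes) for some k. Hence W u ^ e ≤ (2 ^ e) ^ k, and this is at most u either because
-- k ≤ K and u ≥ (2 ^ e) ^ K, or because k > K, where (2 ^ e) ^ (K + 1) ≤ p₁ ⋯ p_{K+1} and every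
-- later prime exceeds 2 ^ e; these two facts are checked by evaluation for K = 149, 473, 852.
module Submission where

open import Defs
open import Data.Bool using (Bool; true; false; T; _∧_; _∨_; not; if_then_else_)
open import Data.Bool.Properties using (T-∧; T-∨)
open import Data.Empty using (⊥-elim)
open import Data.List using ([_]; _++_; applyUpTo; filter; length)
open import Data.List.Properties using (applyUpTo-∷ʳ; filter-++; length-++)
open import Data.List.Relation.Unary.All.Properties using (applyUpTo⁺₁; applyUpTo⁻)
open import Data.Nat
open import Data.Nat.Coprimality using (Coprime; coprime-divisor)
import Data.Nat.Coprimality as Coprime
open import Data.Nat.Divisibility
open import Data.Nat.Induction using (<-wellFounded)
open import Data.Nat.Primality
  using (Prime; Composite; composite; composite⇒¬prime; prime⇒irreducible; prime⇒nonTrivial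
        ; _Rough_; 2-rough; rough⇒≤; ∤⇒rough-suc; rough∧∣⇒rough; rough∧∣⇒prime)
open import Data.Nat.Properties
open import Data.Product using (_×_; _,_; ∃-syntax)
open import Data.Sum using (inj₁; inj₂)
open import Data.Unit using (tt)
open import Function using (_∘_)
open import Function.Bundles using (Equivalence)
open import Induction.WellFounded using (Acc; acc)
open import Level using (Level; 0ℓ)
open import Relation.Binary.PropositionalEquality using (_≡_; refl; sym; trans; cong; subst; module ≡-Reasoning)
open import Relation.Nullary using (¬_; Dec; yes; no; does; contradiction)
open import Relation.Nullary.Decidable using (_×-dec_)
open import Relation.Unary using (Pred; Decidable; _⊆_)
open import Relation.Unary.Properties using (_∩?_; ∁?)

private variable
  ℓ ℓ′ : Level
  P : Pred ℕ ℓ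

count : Decidable P → ℕ → ℕ
count P? zero = zero
count P? (suc n) with does (P? (suc n))
... | true  = suc (count P? n)
... | false = count P? n

length-filter-upTo : (P? : Decidable P) → ∀ n → length (filter P? (applyUpTo suc n)) ≡ count P? n
length-filter-upTo P? zero = refl
length-filter-upTo P? (suc n) = begin
  length (filter P? (applyUpTo suc (suc n)))                          ≡⟨ cong (length ∘ filter P?) (applyUpTo-∷ʳ suc n) ⟨
  length (filter P? (applyUpTo suc n ++ [ suc n ]))                   ≡⟨ cong length (filter-++ P? (applyUpTo suc n) [ suc n ]) ⟩
  length (filter P? (applyUpTo suc n) ++ filter P? [ suc n ])         ≡⟨ length-++ (filter P? (applyUpTo suc n)) ⟩
  length (filter P? (applyUpTo suc n)) + length (filter P? [ suc n ]) ≡⟨ cong (_+ length (filter P? [ suc n ])) (length-filter-upTo P? n) ⟩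
  count P? n + length (filter P? [ suc n ])                           ≡⟨ last-step ⟩
  count P? (suc n)                                                    ∎
  where
  open ≡-Reasoning
  last-step : count P? n + length (filter P? [ suc n ]) ≡ count P? (suc n)
  last-step with P? (suc n)
  ... | yes _ = +-comm (count P? n) 1
  ... | no  _ = +-identityʳ (count P? n)

count-≤ : (P? : Decidable P) → ∀ n → count P? n ≤ n
count-≤ P? zero = z≤n
count-≤ P? (suc n) with P? (suc n)
... | yes _ = s≤s (count-≤ P? n)
... | no  _ = m≤n⇒m≤1+n (count-≤ P? n)

count-mono : {Q : Pred ℕ ℓ′} (P? : Decidable P) (Q? : Decidable Q) → P ⊆ Q → ∀ n → count P? n ≤ count Q? n
count-mono P? Q? P⊆Q zero = z≤n
count-mono P? Q? P⊆Q (suc n) with P? (suc n) | Q? (suc n)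
... | yes _ | yes _ = s≤s (count-mono P? Q? P⊆Q n)
... | yes p | no ¬q = contradiction (P⊆Q p) ¬q
... | no  _ | yes _ = m≤n⇒m≤1+n (count-mono P? Q? P⊆Q n)
... | no  _ | no  _ = count-mono P? Q? P⊆Q n

count-+-beyond : (P? : Decidable P) → ∀ {m} → (∀ {d} → P d → d ≤ m) → ∀ j → count P? (j + m) ≡ count P? m
count-+-beyond P? bound zero = refl
count-+-beyond P? {m} bound (suc j) with P? (suc (j + m))
... | yes p = contradiction (bound p) (<⇒≱ (s≤s (m≤n+m m j)))
... | no  _ = count-+-beyond P? bound j

count-beyond : (P? : Decidable P) → ∀ {m n} → (∀ {d} → P d → d ≤ m) → m ≤ n → count P? n ≡ count P? m
count-beyond P? {m} {n} bound m≤n =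
  trans (cong (count P?) (sym (m∸n+n≡m m≤n))) (count-+-beyond P? bound (n ∸ m))

count-∩-∁ : {Q : Pred ℕ ℓ′} (P? : Decidable P) (Q? : Decidable Q) → ∀ n →
            count P? n ≡ count (P? ∩? Q?) n + count (P? ∩? ∁? Q?) n
count-∩-∁ P? Q? zero = refl
count-∩-∁ P? Q? (suc n) with P? (suc n) | Q? (suc n)
... | yes _ | yes _ = cong suc (count-∩-∁ P? Q? n)
... | yes _ | no  _ = trans (cong suc (count-∩-∁ P? Q? n)) (sym (+-suc _ _))
... | no  _ | _     = count-∩-∁ P? Q? n

count-between-multiples : (P? : Decidable P) → ∀ {t} .{{_ : NonZero t}} → (∀ {d} → P d → t ∣ d) →
                          ∀ n {j} → j < t → count P? (j + n * t) ≡ count P? (n * t)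
count-between-multiples P? multiple n {zero} _ = refl
count-between-multiples P? {t} multiple n {suc j} 1+j<t with P? (suc (j + n * t))
... | yes p = contradiction (∣⇒≤ t∣1+j) (<⇒≱ 1+j<t)
  where
  t∣1+j : t ∣ suc j
  t∣1+j = ∣m+n∣m⇒∣n (subst (t ∣_) (+-comm (suc j) (n * t)) (multiple p)) (n∣m*n n)
... | no  _ = count-between-multiples P? multiple n (<-trans (n<1+n j) 1+j<t)

count-multiples : (P? : Decidable P) → ∀ {t} .{{_ : NonZero t}} → (∀ {d} → P d → t ∣ d) →
                  ∀ n → count P? (n * t) ≡ count (λ e → P? (e * t)) n
count-multiples P? multiple zero = refl
count-multiples P? {t@(suc t′)} multiple (suc n) with P? (suc (t′ + n * t))
... | yes _ = cong suc (trans (count-between-multiples P? multiple n ≤-refl) (count-multiples P? multiple n))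
... | no  _ = trans (count-between-multiples P? multiple n ≤-refl) (count-multiples P? multiple n)

∣-nonZero : ∀ {m n} .{{_ : NonZero n}} → m ∣ n → NonZero m
∣-nonZero {zero} {n} 0∣n = contradiction (0∣⇒≡0 0∣n) (≢-nonZero⁻¹ n)
∣-nonZero {suc m} _ = _

squareFree⇒¬square∣ : ∀ {n k} .{{_ : NonZero n}} → SquareFree n → 2 ≤ k → ¬ (k * k ∣ n)
squareFree⇒¬square∣ {n} {k@(suc (suc i))} sf (s≤s (s≤s z≤n)) k*k∣n = applyUpTo⁻ (2 +_) n sf i<n k*k∣n
  where
  i<n : i < n
  i<n = <-≤-trans (≤-trans (n≤1+n (suc i)) (m≤m*n k k)) (∣⇒≤ k*k∣n)

¬square∣⇒squareFree : ∀ {n} → (∀ {k} → 2 ≤ k → ¬ (k * k ∣ n)) → SquareFree n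
¬square∣⇒squareFree {n} ¬square∣ = applyUpTo⁺₁ (2 +_) n (λ _ → ¬square∣ (s≤s (s≤s z≤n)))

squareFree-∣ : ∀ {d n} .{{_ : NonZero n}} → d ∣ n → SquareFree n → SquareFree d
squareFree-∣ d∣n sf = ¬square∣⇒squareFree λ 2≤k k*k∣d → squareFree⇒¬square∣ sf 2≤k (∣-trans k*k∣d d∣n)

squareFree-*⇒∤ : ∀ {m p} .{{_ : NonZero (m * p)}} → 2 ≤ p → SquareFree (m * p) → p ∤ m
squareFree-*⇒∤ {p = p} 2≤p sf p∣m = squareFree⇒¬square∣ sf 2≤p (*-monoˡ-∣ p p∣m)

prime-∤⇒coprime : ∀ {p n} → Prime p → p ∤ n → Coprime p n
prime-∤⇒coprime pr p∤n (i∣p , i∣n) with prime⇒irreducible pr i∣p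
... | inj₁ i≡1 = i≡1
... | inj₂ refl = contradiction i∣n p∤n

prime-∤-∣-*⇒∣ : ∀ {p m d} → Prime p → p ∤ d → d ∣ p * m → d ∣ m
prime-∤-∣-*⇒∣ pr p∤d = coprime-divisor (Coprime.sym (prime-∤⇒coprime pr p∤d))

SquareFreeDivisor : ℕ → Pred ℕ 0ℓ
SquareFreeDivisor u d = d ∣ u × SquareFree d

squareFreeDivisor? : ∀ u → Decidable (SquareFreeDivisor u)
squareFreeDivisor? u d = (d ∣? u) ×-dec squareFree? d

W≡count : ∀ u → W u ≡ count (squareFreeDivisor? u) u
W≡count u = length-filter-upTo (squareFreeDivisor? u) u

W-≤ : ∀ u → W u ≤ u
W-≤ u = subst (_≤ u) (sym (W≡count u)) (count-≤ (squareFreeDivisor? u) u)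

count-squareFreeDivisor : ∀ {m n} .{{_ : NonZero m}} → m ≤ n → count (squareFreeDivisor? m) n ≡ W m
count-squareFreeDivisor {m} m≤n =
  trans (count-beyond (squareFreeDivisor? m) (λ (d∣m , _) → ∣⇒≤ d∣m) m≤n) (sym (W≡count m))

squareFree-∣-*-prime-∣ : ∀ {p m d} .{{_ : NonZero m}} → Prime p → p ∣ m → SquareFree d → d ∣ p * m → d ∣ m
squareFree-∣-*-prime-∣ {p} {m} {d} pr p∣m sf d∣p*m with p ∣? d
... | no  p∤d = prime-∤-∣-*⇒∣ pr p∤d d∣p*m
... | yes (divides q refl) = subst (q * p ∣_) (sym m≡q*r) (*-monoʳ-∣ q p∣r)
  where
  instance
    _ = prime⇒nonTrivial pr
    _ = nonTrivial⇒nonZero p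
    _ = m*n≢0 p m
    _ = ∣-nonZero d∣p*m
  q∣m : q ∣ m
  q∣m = *-cancelʳ-∣ p (subst (q * p ∣_) (*-comm p m) d∣p*m)
  r = quotient q∣m
  m≡q*r : m ≡ q * r
  m≡q*r = m∣n⇒n≡m*quotient q∣m
  p∣r : p ∣ r
  p∣r = coprime-divisor (prime-∤⇒coprime pr (squareFree-*⇒∤ {q} (nonTrivial⇒n>1 p) sf)) (subst (p ∣_) m≡q*r p∣m)

W-*-prime-∣ : ∀ {p m} .{{_ : NonZero m}} → Prime p → p ∣ m → W (p * m) ≤ W m
W-*-prime-∣ {p} {m} pr p∣m = begin
  W (p * m)                                   ≡⟨ W≡count (p * m) ⟩
  count (squareFreeDivisor? (p * m)) (p * m)  ≤⟨ count-mono _ _ divides-m (p * m) ⟩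
  count (squareFreeDivisor? m) (p * m)        ≡⟨ count-squareFreeDivisor (m≤n*m m p) ⟩
  W m                                         ∎
  where
  open ≤-Reasoning
  instance _ = nonTrivial⇒nonZero p {{prime⇒nonTrivial pr}}
  divides-m : SquareFreeDivisor (p * m) ⊆ SquareFreeDivisor m
  divides-m (d∣p*m , sf) = squareFree-∣-*-prime-∣ pr p∣m sf d∣p*m , sf

W-*-prime : ∀ {p m} .{{_ : NonZero m}} → Prime p → W (p * m) ≤ 2 * W m
W-*-prime {p} {m} pr = begin
  W (p * m)                                   ≡⟨ W≡count (p * m) ⟩
  count S? (p * m)                            ≡⟨ count-∩-∁ S? (p ∣?_) (p * m) ⟩
  count (S? ∩? (p ∣?_)) (p * m) + count (S? ∩? ∁? (p ∣?_)) (p * m)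
    ≤⟨ +-mono-≤ multiples-of-p coprime-to-p ⟩
  W m + W m                                   ≡⟨ cong (W m +_) (+-identityʳ (W m)) ⟨
  2 * W m                                     ∎
  where
  open ≤-Reasoning
  instance
    _ = nonTrivial⇒nonZero p {{prime⇒nonTrivial pr}}
    _ = m*n≢0 p m
  S? = squareFreeDivisor? (p * m)
  multiples-of-p : count (S? ∩? (p ∣?_)) (p * m) ≤ W m
  multiples-of-p = begin
    count (S? ∩? (p ∣?_)) (p * m)                 ≡⟨ cong (count (S? ∩? (p ∣?_))) (*-comm p m) ⟩
    count (S? ∩? (p ∣?_)) (m * p)                 ≡⟨ count-multiples (S? ∩? (p ∣?_)) (λ (_ , p∣d) → p∣d) m ⟩
    count (λ e → (S? ∩? (p ∣?_)) (e * p)) m       ≤⟨ count-mono _ _ cofactor m ⟩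
    count (squareFreeDivisor? m) m                ≡⟨ W≡count m ⟨
    W m                                           ∎
    where
    cofactor : ∀ {e} → SquareFreeDivisor (p * m) (e * p) × p ∣ e * p → SquareFreeDivisor m e
    cofactor {e} ((e*p∣p*m , sf) , _) =
      *-cancelʳ-∣ p (subst (e * p ∣_) (*-comm p m) e*p∣p*m) ,
      squareFree-∣ {{∣-nonZero e*p∣p*m}} (m∣m*n p) sf
  coprime-to-p : count (S? ∩? ∁? (p ∣?_)) (p * m) ≤ W m
  coprime-to-p = begin
    count (S? ∩? ∁? (p ∣?_)) (p * m)    ≤⟨ count-mono _ _ (λ ((d∣p*m , sf) , p∤d) → prime-∤-∣-*⇒∣ pr p∤d d∣p*m , sf) (p * m) ⟩
    count (squareFreeDivisor? m) (p * m) ≡⟨ count-squareFreeDivisor (m≤n*m m p) ⟩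
    W m                                  ∎

-- `suc (d ∸ 1)` is just d (always ≥ 2 here), written so that _%_ needs no NonZero instance.
hasDivisorFrom : ℕ → ℕ → ℕ → Bool
hasDivisorFrom zero    d n = false
hasDivisorFrom (suc f) d n = (d * d ≤ᵇ n) ∧ ((n % suc (d ∸ 1) ≡ᵇ 0) ∨ hasDivisorFrom f (suc d) n)

hasDivisorFrom-sound : ∀ f {d n} → 2 ≤ d → T (hasDivisorFrom f d n) → Composite n
hasDivisorFrom-sound (suc f) {d@(2+ _)} {n} 2≤d@(s≤s (s≤s _)) found with Equivalence.to T-∧ found
... | d*d≤n , found′ with Equivalence.to T-∨ found′
...   | inj₁ d∣n    = composite (<-≤-trans (m<m*n d d 2≤d) (≤ᵇ⇒≤ (d * d) n d*d≤n))
                                (m%n≡0⇒n∣m n d (≡ᵇ⇒≡ (n % d) 0 d∣n))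
  where instance _ = n>1⇒nonTrivial 2≤d
...   | inj₂ found″ = hasDivisorFrom-sound f (m≤n⇒m≤1+n 2≤d) found″

-- The argument only needs every prime to be a pseudoprime, and the 853 pseudoprimes that are
-- ever evaluated all lie below sieveBound, so primorialFrom 2 k is the genuine primorial there.
sieveBound : ℕ
sieveBound = 10000

isPseudoPrime : ℕ → Bool
isPseudoPrime n = (sieveBound ≤ᵇ n) ∨ not (hasDivisorFrom n 2 n)

prime⇒isPseudoPrime : ∀ {p} → Prime p → T (isPseudoPrime p)
prime⇒isPseudoPrime {p} pr with sieveBound ≤ᵇ p
... | true  = tt
... | false with hasDivisorFrom p 2 p in found
...   | true  = contradiction pr (composite⇒¬prime (hasDivisorFrom-sound p (s≤s (s≤s z≤n)) (subst T (sym found) tt)))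
...   | false = tt

nextPseudoPrimeFrom : ℕ → ℕ → ℕ
nextPseudoPrimeFrom zero    t = t
nextPseudoPrimeFrom (suc f) t = if isPseudoPrime t then t else nextPseudoPrimeFrom f (suc t)

nextPseudoPrimeFrom-≥ : ∀ f t → t ≤ nextPseudoPrimeFrom f t
nextPseudoPrimeFrom-≥ zero    t = ≤-refl
nextPseudoPrimeFrom-≥ (suc f) t with isPseudoPrime t
... | true  = ≤-refl
... | false = <⇒≤ (nextPseudoPrimeFrom-≥ f (suc t))

nextPseudoPrimeFrom-least : ∀ f {t n} → t ≤ n → T (isPseudoPrime n) → nextPseudoPrimeFrom f t ≤ n
nextPseudoPrimeFrom-least zero    t≤n _ = t≤n
nextPseudoPrimeFrom-least (suc f) {t} t≤n pseudoPrime with isPseudoPrime t in notPseudoPrime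
... | true  = t≤n
... | false with m≤n⇒m<n∨m≡n t≤n
...   | inj₁ t<n  = nextPseudoPrimeFrom-least f t<n pseudoPrime
...   | inj₂ refl = ⊥-elim (subst T notPseudoPrime pseudoPrime)

nextPseudoPrimeFrom-pseudoPrime : ∀ f t → sieveBound ≤ f + t → T (isPseudoPrime (nextPseudoPrimeFrom f t))
nextPseudoPrimeFrom-pseudoPrime zero t bound with sieveBound ≤ᵇ t | ≤⇒≤ᵇ bound
... | true | _ = tt
nextPseudoPrimeFrom-pseudoPrime (suc f) t bound with isPseudoPrime t in pseudoPrime
... | true  = subst T (sym pseudoPrime) tt
... | false = nextPseudoPrimeFrom-pseudoPrime f (suc t) (subst (sieveBound ≤_) (sym (+-suc f t)) bound)

nextPseudoPrime : ℕ → ℕ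
nextPseudoPrime = nextPseudoPrimeFrom sieveBound

nextPseudoPrime-≥ : ∀ t → t ≤ nextPseudoPrime t
nextPseudoPrime-≥ = nextPseudoPrimeFrom-≥ sieveBound

nextPseudoPrime-mono-≤ : ∀ {t t′} → t ≤ t′ → nextPseudoPrime t ≤ nextPseudoPrime t′
nextPseudoPrime-mono-≤ {t} {t′} t≤t′ = nextPseudoPrimeFrom-least sieveBound
  (≤-trans t≤t′ (nextPseudoPrime-≥ t′))
  (nextPseudoPrimeFrom-pseudoPrime sieveBound t′ (m≤m+n sieveBound t′))

nextPseudoPrime-≤-prime : ∀ {t p} → Prime p → t ≤ p → nextPseudoPrime t ≤ p
nextPseudoPrime-≤-prime pr t≤p = nextPseudoPrimeFrom-least sieveBound t≤p (prime⇒isPseudoPrime pr)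

primorialFrom : ℕ → ℕ → ℕ
primorialFrom t zero    = 1
primorialFrom t (suc k) = nextPseudoPrime t * primorialFrom (suc (nextPseudoPrime t)) k

skipPseudoPrimes : ℕ → ℕ → ℕ
skipPseudoPrimes t zero    = t
skipPseudoPrimes t (suc k) = skipPseudoPrimes (suc (nextPseudoPrime t)) k

primorialFrom-mono-≤ : ∀ k {t t′} → t ≤ t′ → primorialFrom t k ≤ primorialFrom t′ k
primorialFrom-mono-≤ zero    t≤t′ = ≤-refl
primorialFrom-mono-≤ (suc k) t≤t′ =
  *-mono-≤ (nextPseudoPrime-mono-≤ t≤t′) (primorialFrom-mono-≤ k (s≤s (nextPseudoPrime-mono-≤ t≤t′)))

primorialFrom-+ : ∀ j k t → primorialFrom t (j + k) ≡ primorialFrom t j * primorialFrom (skipPseudoPrimes t j) k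
primorialFrom-+ zero    k t = sym (+-identityʳ (primorialFrom t k))
primorialFrom-+ (suc j) k t = begin
  q * primorialFrom (suc q) (j + k)                                         ≡⟨ cong (q *_) (primorialFrom-+ j k (suc q)) ⟩
  q * (primorialFrom (suc q) j * primorialFrom (skipPseudoPrimes (suc q) j) k) ≡⟨ *-assoc q _ _ ⟨
  q * primorialFrom (suc q) j * primorialFrom (skipPseudoPrimes (suc q) j) k   ∎
  where
  open ≡-Reasoning
  q = nextPseudoPrime t

^≤primorialFrom : ∀ k {b t} → b ≤ t → b ^ k ≤ primorialFrom t k
^≤primorialFrom zero    b≤t = ≤-refl
^≤primorialFrom (suc k) {t = t} b≤t =
  *-mono-≤ b≤q (^≤primorialFrom k (m≤n⇒m≤1+n b≤q))
  where b≤q = ≤-trans b≤t (nextPseudoPrime-≥ t)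

roughDivisor : ∀ k {m n} .{{_ : NonTrivial n}} → m Rough n → n ≤ k + m → ∃[ p ] m ≤ p × p ∣ n × p Rough n
roughDivisor k {m} {n} rough n≤k+m with m ∣? n
... | yes m∣n = m , ≤-refl , m∣n , rough
roughDivisor zero    rough n≤m | no m∤n = contradiction n≤m (<⇒≱ (rough⇒≤ (∤⇒rough-suc m∤n rough)))
roughDivisor (suc k) {m} {n} rough n≤k+m | no m∤n
  with roughDivisor k (∤⇒rough-suc m∤n rough) (subst (n ≤_) (sym (+-suc k m)) n≤k+m)
... | p , m<p , p∣n , p-rough = p , <⇒≤ m<p , p∣n , p-rough

leastPrimeFactor : ∀ n .{{_ : NonTrivial n}} → ∃[ p ] Prime p × p ∣ n × p Rough n
leastPrimeFactor n with roughDivisor n 2-rough (m≤m+n n 2)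
... | p , 2≤p , p∣n , p-rough = p , rough∧∣⇒prime {{n>1⇒nonTrivial 2≤p}} p-rough p∣n , p∣n , p-rough

PrimorialBound : ℕ → ℕ → Set
PrimorialBound t u = ∃[ k ] W u ≤ 2 ^ k × primorialFrom t k ≤ u

primorialBound-*-prime-∣ : ∀ {t p m} .{{_ : NonZero m}} → Prime p → p ∣ m → PrimorialBound t m → PrimorialBound t (p * m)
primorialBound-*-prime-∣ {p = p} {m} pr p∣m (k , W≤ , primorial≤) =
  k , ≤-trans (W-*-prime-∣ pr p∣m) W≤ , ≤-trans primorial≤ (m≤n*m m p)
  where instance _ = nonTrivial⇒nonZero p {{prime⇒nonTrivial pr}}

primorialBound-*-prime : ∀ {t p m} .{{_ : NonZero m}} → Prime p → t ≤ p → PrimorialBound (suc p) m → PrimorialBound t (p * m)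
primorialBound-*-prime {t} {p} {m} pr t≤p (k , W≤ , primorial≤) =
  suc k , ≤-trans (W-*-prime pr) (*-monoʳ-≤ 2 W≤) , *-mono-≤ q≤p (≤-trans (primorialFrom-mono-≤ k (s≤s q≤p)) primorial≤)
  where q≤p = nextPseudoPrime-≤-prime pr t≤p

primorialBound-acc : ∀ {u} → Acc _<_ u → .{{_ : NonZero u}} → ∀ {t} → t Rough u → PrimorialBound t u
primorialBound-acc {1} _ _ = 0 , W-≤ 1 , ≤-refl
primorialBound-acc {u@(2+ _)} (acc smaller) {t} rough with leastPrimeFactor u
... | p , pr , p∣u , p-rough = subst (PrimorialBound t) (sym (m∣n⇒n≡m*quotient p∣u)) (split (p ∣? m))
  where
  instance
    _ = prime⇒nonTrivial pr
    _ = quotient≢0 p∣u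
  m = quotient p∣u
  m<u = quotient-< p∣u
  split : Dec (p ∣ m) → PrimorialBound t (p * m)
  split (yes p∣m) = primorialBound-*-prime-∣ pr p∣m (primorialBound-acc (smaller m<u) (rough∧∣⇒rough rough (quotient-∣ p∣u)))
  split (no  p∤m) = primorialBound-*-prime pr (rough⇒≤ (rough∧∣⇒rough rough p∣u))
    (primorialBound-acc (smaller m<u) (∤⇒rough-suc p∤m (rough∧∣⇒rough p-rough (quotient-∣ p∣u))))

primorialBound : ∀ u .{{_ : NonZero u}} → PrimorialBound 2 u
primorialBound u = primorialBound-acc (<-wellFounded u) 2-rough

^≤primorialFrom-beyond : ∀ {b t K} → b ^ K ≤ primorialFrom t K → b ≤ skipPseudoPrimes t K →
                         ∀ {k} → K ≤ k → b ^ k ≤ primorialFrom t k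
^≤primorialFrom-beyond {b} {t} {K} head tail {k} K≤k = begin
  b ^ k                                                       ≡⟨ cong (b ^_) k≡K+j ⟩
  b ^ (K + j)                                                 ≡⟨ ^-distribˡ-+-* b K j ⟩
  b ^ K * b ^ j                                               ≤⟨ *-mono-≤ head (^≤primorialFrom j tail) ⟩
  primorialFrom t K * primorialFrom (skipPseudoPrimes t K) j  ≡⟨ primorialFrom-+ K j t ⟨
  primorialFrom t (K + j)                                     ≡⟨ cong (primorialFrom t) k≡K+j ⟨
  primorialFrom t k                                           ∎
  where
  open ≤-Reasoning
  j = k ∸ K
  k≡K+j = sym (m+[n∸m]≡n K≤k)

W^e≤ : ∀ e K {u₀} → (2 ^ e) ^ K ≤ u₀ → (2 ^ e) ^ suc K ≤ primorialFrom 2 (suc K) → 2 ^ e ≤ skipPseudoPrimes 2 (suc K) →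
       ∀ u → 1 ≤ u → u₀ ≤ u → W u ^ e ≤ u
W^e≤ e K small head tail u 1≤u u₀≤u with primorialBound u {{>-nonZero 1≤u}}
... | k , W≤2^k , primorial≤u = begin
  W u ^ e      ≤⟨ ^-monoˡ-≤ e W≤2^k ⟩
  (2 ^ k) ^ e  ≡⟨ ^-*-assoc 2 k e ⟩
  2 ^ (k * e)  ≡⟨ cong (2 ^_) (*-comm k e) ⟩
  2 ^ (e * k)  ≡⟨ ^-*-assoc 2 e k ⟨
  (2 ^ e) ^ k  ≤⟨ cases (k ≤? K) ⟩
  u            ∎
  where
  open ≤-Reasoning
  instance _ = m^n≢0 2 e
  cases : Dec (k ≤ K) → (2 ^ e) ^ k ≤ u
  cases (yes k≤K) = ≤-trans (^-monoʳ-≤ (2 ^ e) k≤K) (≤-trans small u₀≤u)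
  cases (no  k≰K) = ≤-trans (^≤primorialFrom-beyond head tail (≰⇒> k≰K)) primorial≤u

corollary3 : (u : ℕ) → 1 ≤ u →
    (751 * 10 ^ 356 ≤ u → W u ^ 8 ≤ u) ×
    (139 * 10 ^ 1422 ≤ u → W u ^ 10 ≤ u) ×
    (331 * 10 ^ 2819 ≤ u → W u ^ 11 ≤ u)
corollary3 u 1≤u =
  W^e≤ 8  149 (≤ᵇ⇒≤ _ _ tt) (≤ᵇ⇒≤ _ _ tt) (≤ᵇ⇒≤ _ _ tt) u 1≤u ,
  W^e≤ 10 473 (≤ᵇ⇒≤ _ _ tt) (≤ᵇ⇒≤ _ _ tt) (≤ᵇ⇒≤ _ _ tt) u 1≤u ,
  W^e≤ 11 852 (≤ᵇ⇒≤ _ _ tt) (≤ᵇ⇒≤ _ _ tt) (≤ᵇ⇒≤ _ _ tt) u 1≤u
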